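{- Let $P$ be a program, and suppose the Power automaton of $P$ moves from its initial state via a label sequence $\sigma$ to a state $s$ and then via one label $e$ to a state $s'$. If $\mathit{eval}(t,i,e_0)=v\neq\bot$ in state $s$ for a thread $t$, index $i$ and expression $e_0$, then $\mathit{eval}(t,i,e_0)=v$ in state $s'$.
   Context: Programs. Fix a finite set $D$ of values, which also serves as the set of addresses, with $0\in D$; a finite set $\mathit{Reg}$ of registers taking values in $D$; and a set of (deterministic) functions over $D\cup\{\bot\}$, each returning $\bot$ iff some argument is $\bot$. Expressions are built from constants in $D$, registers, and these functions. Commands are: loads $r\leftarrow \mathrm{mem}[e]$, stores $\mathrm{mem}[e]\leftarrow e'$, local assignments $r\leftarrow e$, and $\mathrm{assume}(e)$. A program $P=T_1\cdots T_n$ is a finite sequence of threads with ids $\mathit{Tid}=\{1,\dots,n\}$; thread $T_t$ is a finite automaton with control states $Q_t$ (all final), initial state $q^0_t$, and a finite set $I_t$ of transitions (called instructions) labeled by commands. Power semantics (Power automaton). A state is $(R,(co,prop))$. For each thread $t$, $R(t)=(F,C,L)$ where $F\in I_t^*$ is the sequence of fetched instructions, $C\subseteq[1..|F|]$ the committed indices, and $L:[1..|F|]\to\{\bot\}\cup\{\mathit{init}_a: a\in D\}\cup \mathit{Tid}\times\mathbb N$ records the store read by each load ($\mathit{init}_a$ is an initial store of value $0$ to address $a$; $(t',i')$ denotes the $i'$-th fetched instruction of thread $t'$). $co$ assigns rational coherence keys to committed stores (and key $0$ to initial stores); $prop(t,a)$ is the last store to address $a$ propagated to thread $t$. Initially all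 $F$ are empty, $C=\emptyset$, $L\equiv\bot$, no program store has a key, and $prop(t,a)=\mathit{init}_a$. For the $i$-th fetched instruction of thread $t$, $\mathit{eval}(t,i,e)$ is: $e$ if $e\in D$; $f(\mathit{eval}(t,i,e_1),\dots)$ for $e=f(e_1,\dots)$; for a register $r$, let $i'<i$ be the greatest index such that $F[i']$ is an assignment or a load to $r$: if none, $0$; if $F[i']$ is $r\leftarrow e_v$, then $\mathit{eval}(t,i',e_v)$; if $F[i']$ is a load, then $\bot$ if $L[i']=\bot$, $0$ if $L[i']$ is an initial store, and otherwise the value argument of store $L[i']$ (i.e.\ $\mathit{getvalue}$ of that store). $\mathit{getaddr}(t,i)$ is the evaluated address expression of a load/store and $\top$ for other instructions; $\mathit{getvalue}(t,i)$ is the evaluated value expression of a store, assignment or assume, and $\top$ for loads. Address and data dependencies of instruction $i$ are the earlier instructions defining (recursively) the registers in its address, resp.\ value expression; control dependencies are all earlier assume instructions. Transitions (labels in parentheses): (FETCH) $(\mathrm{fetch},t,\iota)$: append instruction $\iota\in I_t$ to $F$ if its source state is the target of the last fetched instruction (or $q^0_t$ if $F$ is empty). (LOAD) $(\mathrm{ld},t,i,a)$: if $F[i]$ is a load, $L[i]=\bot$, $a=\mathit{getaddr}(t,i)\ne\bot$, set $L[i]:=prop(t,a)$. (EARLY) $(\mathrm{ld},t,i,a)$: if $F[i]$ is a load, $L[i]=\bot$, $a=\mathit{getaddr}(t,i)\neq\bot$, and the greatest $i'<i$ such that $F[i']$ is a store with $\mathit{getaddr}(t,i')\in\{a,\bot\}$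 satisfies $\mathit{getaddr}(t,i')=a$, $\mathit{getvalue}(t,i')\ne\bot$, $i'\notin C$, set $L[i]:=(t,i')$. (COMMIT) $(\mathrm{commit},t,i)$ for a non-store $i\notin C$: requires all address, data, control dependencies committed, $\mathit{getaddr},\mathit{getvalue}\ne\bot$, if the address $a\ne\top$ then all $i'<i$ with $\mathit{getaddr}(t,i')\in\{a,\bot\}$ committed, $L[i]\ne\bot$ for loads, value $\neq0$ for assumes; adds $i$ to $C$. (STORE) $(\mathrm{commit},t,i,k,a)$: same preconditions for a store $i$ with address $a$, choosing a coherence key $k\in\mathbb Q$ not used by any other store; sets $co(t,i):=k$, adds $i$ to $C$, and is immediately followed by propagation of this store to thread $t$. (PROP) $(\mathrm{prop},t,t',i',a)$: if store $(t',i')$ is committed, has address $a$, and $co(prop(t,a))<co(t',i')$, set $prop(t,a):=(t',i')$. -}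

module Defs where

open import Data.Nat using (ℕ; zero; suc; _<_; _≡ᵇ_)
open import Data.Fin using (Fin; zero; suc; _≟_)
open import Data.Vec using (Vec; []; _∷_)
open import Data.List using (List; []; _∷_; _++_; [_]; length; last; map)
open import Data.List.Membership.Propositional using (_∈_)
open import Data.Maybe using (Maybe; just; nothing)
import Data.Maybe as Maybe
open import Data.Bool using (Bool; true; false; if_then_else_; _∧_)
open import Data.Product using (Σ; ∃; _×_; _,_)
open import Data.Sum using (_⊎_)
open import Data.Rational using (ℚ; 0ℚ) renaming (_<_ to _<ℚ_)
open import Relation.Nullary using (¬_; yes; no)
open import Relation.Nullary.Decidable using (⌊_⌋)
open import Relation.Binary.PropositionalEquality using (_≡_; _≢_; refl)

-- Values / addresses: D = Fin (suc nD), with 0 ∈ D being `zero`.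
-- The undefined value ⊥ is `nothing` (D ∪ {⊥} = Maybe D).

Val : ℕ → Set
Val nD = Fin (suc nD)

-- Expressions over registers Fin nR.  A function symbol of arity k is a
-- (deterministic) function Vec D k → D, lifted strictly to D ∪ {⊥}
-- (it returns ⊥ iff some argument is ⊥).
data Expr (nD nR : ℕ) : Set where
  const : Val nD → Expr nD nR
  reg   : Fin nR → Expr nD nR
  app   : ∀ {k} → (Vec (Val nD) k → Val nD) → Vec (Expr nD nR) k → Expr nD nR

data Cmd (nD nR : ℕ) : Set where
  load   : Fin nR → Expr nD nR → Cmd nD nR               -- r ← mem[e]
  store  : Expr nD nR → Expr nD nR → Cmd nD nR           -- mem[e] ← e'
  assign : Fin nR → Expr nD nR → Cmd nD nR
  assume : Expr nD nR → Cmd nD nR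

record Instr (nD nR Q : ℕ) : Set where
  constructor instr
  field
    src : Fin Q
    cmd : Cmd nD nR
    tgt : Fin Q

record Thread (nD nR : ℕ) : Set where
  field
    nQ     : ℕ
    q0     : Fin nQ
    instrs : List (Instr nD nR nQ)

record Program (nD nR : ℕ) : Set where
  field
    nT  : ℕ
    thr : Fin nT → Thread nD nR

at : ∀ {A : Set} → List A → ℕ → Maybe A
at []       _       = nothing
at (x ∷ xs) zero    = just x
at (x ∷ xs) (suc n) = at xs n

allJust : ∀ {A : Set} {k} → Vec (Maybe A) k → Maybe (Vec A k)
allJust []             = just []
allJust (nothing ∷ xs) = nothing
allJust (just x ∷ xs)  = Maybe.map (x ∷_) (allJust xs)

updN : ∀ {A : Set} → ℕ → A → (ℕ → A) → ℕ → A
updN i x g j = if j ≡ᵇ i then x else g j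

mutual
  data _∈R_ {nD nR} (r : Fin nR) : Expr nD nR → Set where
    here-reg : r ∈R reg r
    in-app   : ∀ {k} {f : Vec (Val nD) k → Val nD} {es} → r ∈Rs es → r ∈R app f es

  data _∈Rs_ {nD nR} (r : Fin nR) : ∀ {k} → Vec (Expr nD nR) k → Set where
    hd : ∀ {k e} {es : Vec (Expr nD nR) k} → r ∈R e  → r ∈Rs (e ∷ es)
    tl : ∀ {k e} {es : Vec (Expr nD nR) k} → r ∈Rs es → r ∈Rs (e ∷ es)

data Defines {nD nR} : Cmd nD nR → Fin nR → Set where
  def-load   : ∀ {r e} → Defines (load r e) r
  def-assign : ∀ {r e} → Defines (assign r e) r

-- address expression (nothing = ⊤, no address)
addrExpr : ∀ {nD nR} → Cmd nD nR → Maybe (Expr nD nR)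
addrExpr (load _ e)  = just e
addrExpr (store e _) = just e
addrExpr (assign _ _) = nothing
addrExpr (assume _)  = nothing

-- value expression (nothing = ⊤, for loads)
valExpr : ∀ {nD nR} → Cmd nD nR → Maybe (Expr nD nR)
valExpr (load _ _)   = nothing
valExpr (store _ e)  = just e
valExpr (assign _ e) = just e
valExpr (assume e)   = just e

data IsStore {nD nR} : Cmd nD nR → Set where
  is-store : ∀ {e e'} → IsStore (store e e')

data IsLoad {nD nR} : Cmd nD nR → Set where
  is-load : ∀ {r e} → IsLoad (load r e)

data IsAssume {nD nR} : Cmd nD nR → Set where
  is-assume : ∀ {e} → IsAssume (assume e)

data Res (nD : ℕ) : Set where
  top : Res nD
  res : Maybe (Val nD) → Res nD

-- The Power automaton of a program P.
-- Indices of fetched instructions are 0-based here: index i denotes the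
-- paper's (i+1)-th fetched instruction.

module Power {nD nR : ℕ} (P : Program nD nR) where
  open Program P

  D : Set
  D = Val nD

  Tid : Set
  Tid = Fin nT

  Q : Tid → ℕ
  Q t = Thread.nQ (thr t)

  Ins : Tid → Set
  Ins t = Instr nD nR (Q t)

  -- store identifiers: initial stores init_a, and program stores (t', i')
  data StoreId : Set where
    initS : D → StoreId
    prog  : Tid → ℕ → StoreId

  record TState (t : Tid) : Set where
    constructor tstate
    field
      F : List (Ins t)            -- fetched instructions
      C : ℕ → Bool                -- committed indices
      L : ℕ → Maybe StoreId       -- store read by each load (nothing = ⊥)

  record State : Set where
    constructor state
    field
      R    : (t : Tid) → TState t
      co   : Tid → ℕ → Maybe ℚ    -- coherence keys of committed program stores
      prop : Tid → D → StoreId    -- last store to a propagated to t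

  open TState
  open State

  initState : State
  initState = state (λ t → tstate [] (λ _ → false) (λ _ → nothing))
                    (λ _ _ → nothing) (λ _ a → initS a)

  Fs : State → (t : Tid) → List (Ins t)
  Fs s t = F (R s t)

  Cs : State → Tid → ℕ → Bool
  Cs s t = C (R s t)

  Ls : State → Tid → ℕ → Maybe StoreId
  Ls s t = L (R s t)

  cmdAt : State → Tid → ℕ → Maybe (Cmd nD nR)
  cmdAt s t i = Maybe.map Instr.cmd (at (Fs s t) i)

  key : State → StoreId → Maybe ℚ
  key s (initS _)  = just 0ℚ
  key s (prog t i) = co s t i

  NoDefBetween : State → Tid → ℕ → ℕ → Fin nR → Set
  NoDefBetween s t lo hi r =
    ∀ j c → lo < j → j < hi → cmdAt s t j ≡ just c → ¬ Defines c r

  NoDefBefore : State → Tid → ℕ → Fin nR → Set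
  NoDefBefore s t hi r = ∀ j c → j < hi → cmdAt s t j ≡ just c → ¬ Defines c r

  -- eval(t,i,e) = v   (v ∈ D ∪ {⊥}), as the graph of the recursive
  -- definition of the paper.
  mutual
    data Eval (s : State) : Tid → ℕ → Expr nD nR → Maybe D → Set where
      ev-const : ∀ {t i d} → Eval s t i (const d) (just d)
      ev-app   : ∀ {t i k} {f : Vec D k → D} {es : Vec (Expr nD nR) k} {vs} →
                 EvalArgs s t i es vs → Eval s t i (app f es) (Maybe.map f (allJust vs))
      ev-reg-none : ∀ {t i r} → NoDefBefore s t i r → Eval s t i (reg r) (just zero)
      ev-reg-assign : ∀ {t i r i' e v} → i' < i → NoDefBetween s t i' i r →
                 cmdAt s t i' ≡ just (assign r e) → Eval s t i' e v →
                 Eval s t i (reg r) v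
      ev-reg-load-bot : ∀ {t i r i' e} → i' < i → NoDefBetween s t i' i r →
                 cmdAt s t i' ≡ just (load r e) → Ls s t i' ≡ nothing →
                 Eval s t i (reg r) nothing
      ev-reg-load-init : ∀ {t i r i' e a} → i' < i → NoDefBetween s t i' i r →
                 cmdAt s t i' ≡ just (load r e) → Ls s t i' ≡ just (initS a) →
                 Eval s t i (reg r) (just zero)
      ev-reg-load-prog : ∀ {t i r i' e t'' i'' ea ev v} → i' < i →
                 NoDefBetween s t i' i r →
                 cmdAt s t i' ≡ just (load r e) → Ls s t i' ≡ just (prog t'' i'') →
                 cmdAt s t'' i'' ≡ just (store ea ev) → Eval s t'' i'' ev v →
                 Eval s t i (reg r) v

    data EvalArgs (s : State) (t : Tid) (i : ℕ) :
         ∀ {k} → Vec (Expr nD nR) k → Vec (Maybe D) k → Set where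
      []  : EvalArgs s t i [] []
      _∷_ : ∀ {k e v} {es : Vec (Expr nD nR) k} {vs} →
            Eval s t i e v → EvalArgs s t i es vs → EvalArgs s t i (e ∷ es) (v ∷ vs)

  EvalAt : State → Tid → ℕ → Expr nD nR → Maybe D → Set
  EvalAt s t i e v = i < length (Fs s t) × Eval s t i e v

  data GetAddr (s : State) (t : Tid) (i : ℕ) : Res nD → Set where
    ga-top : ∀ {c} → cmdAt s t i ≡ just c → addrExpr c ≡ nothing → GetAddr s t i top
    ga-val : ∀ {c e v} → cmdAt s t i ≡ just c → addrExpr c ≡ just e →
             Eval s t i e v → GetAddr s t i (res v)

  data GetValue (s : State) (t : Tid) (i : ℕ) : Res nD → Set where
    gv-top : ∀ {c} → cmdAt s t i ≡ just c → valExpr c ≡ nothing → GetValue s t i top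
    gv-val : ∀ {c e v} → cmdAt s t i ≡ just c → valExpr c ≡ just e →
             Eval s t i e v → GetValue s t i (res v)

  data DepVia (s : State) (t : Tid) : ℕ → Expr nD nR → ℕ → Set where
    dep-direct : ∀ {i e r j c} → r ∈R e → j < i → NoDefBetween s t j i r →
                 cmdAt s t j ≡ just c → Defines c r → DepVia s t i e j
    dep-trans  : ∀ {i e r j e' k} → r ∈R e → j < i → NoDefBetween s t j i r →
                 cmdAt s t j ≡ just (assign r e') → DepVia s t j e' k → DepVia s t i e k

  AddrDep : State → Tid → ℕ → ℕ → Set
  AddrDep s t i j = ∃ λ c → ∃ λ e → cmdAt s t i ≡ just c × addrExpr c ≡ just e × DepVia s t i e j

  DataDep : State → Tid → ℕ → ℕ → Set
  DataDep s t i j = ∃ λ c → ∃ λ e → cmdAt s t i ≡ just c × valExpr c ≡ just e × DepVia s t i e j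

  CtrlDep : State → Tid → ℕ → ℕ → Set
  CtrlDep s t i j = j < i × ∃ λ c → cmdAt s t j ≡ just c × IsAssume c

  record CanCommit (s : State) (t : Tid) (i : ℕ) (c : Cmd nD nR) : Set where
    field
      notCommitted : Cs s t i ≡ false
      addrDeps : ∀ j → AddrDep s t i j → Cs s t j ≡ true
      dataDeps : ∀ j → DataDep s t i j → Cs s t j ≡ true
      ctrlDeps : ∀ j → CtrlDep s t i j → Cs s t j ≡ true
      addrDef  : ∃ λ x → GetAddr s t i x × x ≢ res nothing
      valDef   : ∃ λ x → GetValue s t i x × x ≢ res nothing
      sameAddr : ∀ a → GetAddr s t i (res (just a)) →
                 ∀ j x → j < i → GetAddr s t j x → (x ≡ res (just a) ⊎ x ≡ res nothing) →
                 Cs s t j ≡ true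
      loadRead : IsLoad c → Ls s t i ≢ nothing
      assumeOK : IsAssume c → ∃ λ v → GetValue s t i (res (just v)) × v ≢ zero

  updR : (t : Tid) → (TState t → TState t) → ((u : Tid) → TState u) → (u : Tid) → TState u
  updR t f g u with t ≟ u
  ... | yes refl = f (g t)
  ... | no _     = g u

  setL : (t : Tid) → ℕ → StoreId → State → State
  setL t i x s = record s { R = updR t (λ ts → record ts { L = updN i (just x) (L ts) }) (R s) }

  setC : (t : Tid) → ℕ → State → State
  setC t i s = record s { R = updR t (λ ts → record ts { C = updN i true (C ts) }) (R s) }

  setCo : Tid → ℕ → ℚ → State → State
  setCo t i k s = record s { co = λ u j → if ⌊ u ≟ t ⌋ ∧ (j ≡ᵇ i) then just k else co s u j }

  setProp : Tid → D → StoreId → State → State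
  setProp t a x s = record s { prop = λ u b → if ⌊ u ≟ t ⌋ ∧ ⌊ b ≟ a ⌋ then x else prop s u b }

  appendF : (t : Tid) → Ins t → State → State
  appendF t ι s = record s { R = updR t (λ ts → record ts { F = F ts ++ [ ι ] }) (R s) }

  nextSrc : (t : Tid) → List (Ins t) → Fin (Q t)
  nextSrc t fs with last fs
  ... | nothing = Thread.q0 (thr t)
  ... | just ι  = Instr.tgt ι

  data Label : Set where
    fetchL  : (t : Tid) → Ins t → Label
    ldL     : Tid → ℕ → D → Label
    commitL : Tid → ℕ → Label
    storeL  : Tid → ℕ → ℚ → D → Label                   -- (commit, t, i, k, a)
    propL   : Tid → Tid → ℕ → D → Label

  data Step (s : State) : Label → State → Set where
    FETCH  : ∀ {t} {ι : Ins t} → ι ∈ Thread.instrs (thr t) →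
             Instr.src ι ≡ nextSrc t (Fs s t) →
             Step s (fetchL t ι) (appendF t ι s)
    LOAD   : ∀ {t i a r e} → cmdAt s t i ≡ just (load r e) → Ls s t i ≡ nothing →
             GetAddr s t i (res (just a)) →
             Step s (ldL t i a) (setL t i (prop s t a) s)
    EARLY  : ∀ {t i a r e i' ea ev v} → cmdAt s t i ≡ just (load r e) → Ls s t i ≡ nothing →
             GetAddr s t i (res (just a)) →
             -- i' is the greatest index < i of a store with getaddr ∈ {a, ⊥}
             i' < i → cmdAt s t i' ≡ just (store ea ev) →
             (∀ j c x → i' < j → j < i → cmdAt s t j ≡ just c → IsStore c →
                GetAddr s t j x → x ≢ res (just a) × x ≢ res nothing) →
             GetAddr s t i' (res (just a)) → GetValue s t i' (res (just v)) →
             Cs s t i' ≡ false →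
             Step s (ldL t i a) (setL t i (prog t i') s)
    COMMIT : ∀ {t i c} → cmdAt s t i ≡ just c → ¬ IsStore c → CanCommit s t i c →
             Step s (commitL t i) (setC t i s)
    STORE  : ∀ {t i c k a k₀} → cmdAt s t i ≡ just c → IsStore c → CanCommit s t i c →
             GetAddr s t i (res (just a)) →
             -- k is not used by any other store (initial stores have key 0)
             (∀ t' i' → co s t' i' ≢ just k) → k ≢ 0ℚ →
             -- the immediately following propagation to t
             key s (prop s t a) ≡ just k₀ → k₀ <ℚ k →
             Step s (storeL t i k a) (setProp t a (prog t i) (setC t i (setCo t i k s)))
    PROP   : ∀ {t t' i' a c k₁ k₂} → Cs s t' i' ≡ true → cmdAt s t' i' ≡ just c → IsStore c →
             GetAddr s t' i' (res (just a)) →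
             key s (prop s t a) ≡ just k₁ → co s t' i' ≡ just k₂ → k₁ <ℚ k₂ →
             Step s (propL t t' i' a) (setProp t a (prog t' i') s)

  data Steps : State → List Label → State → Set where
    done : ∀ {s} → Steps s [] s
    next : ∀ {s ℓ s' σ s''} → Step s ℓ s' → Steps s' σ s'' → Steps s (ℓ ∷ σ) s''

  Reach : List Label → State → Set
  Reach σ s = Steps initState σ s

open Power public

module Submission where

open import Defs
open import Data.Nat using (ℕ; zero; suc; _<_; s≤s; z≤n; _≡ᵇ_)
open import Data.Nat.Properties using (<-trans; ≡ᵇ⇒≡)
open import Data.Fin using (_≟_)
open import Data.List using (List; []; _∷_; _++_; [_]; length)
open import Data.Maybe using (Maybe; just; nothing)
import Data.Maybe as Maybe
open import Data.Vec using (Vec; []; _∷_)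
open import Data.Vec.Relation.Unary.All using (All; []; _∷_)
open import Data.Bool using (true; false)
open import Data.Product using (∃; _,_)
open import Data.Empty using (⊥-elim)
open import Relation.Nullary using (yes; no)
open import Relation.Binary.PropositionalEquality using (_≡_; _≢_; refl; sym; trans; cong)

-- Along any step the fetched sequences only grow and a load that has read a
-- store keeps it.  A defined value of eval(t,i,e) depends on nothing else:
-- only on instructions below i and on the stores read by earlier loads.  Only
-- a load that has not read yet can make a value undefined, which is why the
-- statement is restricted to defined values.

at-just⇒< : ∀ {A : Set} (xs : List A) n {y} → at xs n ≡ just y → n < length xs
at-just⇒< (x ∷ xs) zero    _  = s≤s z≤n
at-just⇒< (x ∷ xs) (suc n) eq = s≤s (at-just⇒< xs n eq)

<⇒at-just : ∀ {A : Set} (xs : List A) n → n < length xs → ∃ λ y → at xs n ≡ just y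
<⇒at-just (x ∷ xs) zero    _         = x , refl
<⇒at-just (x ∷ xs) (suc n) (s≤s n<) = <⇒at-just xs n n<

at-++ˡ : ∀ {A : Set} (xs ys : List A) n → n < length xs → at (xs ++ ys) n ≡ at xs n
at-++ˡ (x ∷ xs) ys zero    _         = refl
at-++ˡ (x ∷ xs) ys (suc n) (s≤s n<) = at-++ˡ xs ys n n<

updN-keeps-just : ∀ {A : Set} {g : ℕ → Maybe A} i j {x y} →
                  g i ≡ nothing → g j ≡ just x → updN i y g j ≡ just x
updN-keeps-just i j gi≡nothing gj≡just with j ≡ᵇ i | ≡ᵇ⇒≡ j i
... | false | _    = gj≡just
... | true  | j≡i with refl ← j≡i _ with () ← trans (sym gi≡nothing) gj≡just

map-defined : ∀ {A B : Set} (f : A → B) (m : Maybe A) → Maybe.map f m ≢ nothing → m ≢ nothing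
map-defined f nothing defined refl = defined refl

allJust-defined⇒All : ∀ {A : Set} {k} (vs : Vec (Maybe A) k) →
                      allJust vs ≢ nothing → All (_≢ nothing) vs
allJust-defined⇒All []             _       = []
allJust-defined⇒All (nothing ∷ vs) defined = ⊥-elim (defined refl)
allJust-defined⇒All (just x ∷ vs)  defined =
  (λ ()) ∷ allJust-defined⇒All vs (map-defined (x ∷_) (allJust vs) defined)

module _ {nD nR : ℕ} (P : Program nD nR) where
  open TState

  record _⊑ᵗ_ {t : Tid P} (ts ts' : TState P t) : Set where
    field
      fetched-kept : ∀ j → j < length (F ts) → at (F ts') j ≡ at (F ts) j
      read-kept    : ∀ j {x} → L ts j ≡ just x → L ts' j ≡ just x

  _⊑_ : State P → State P → Set
  s ⊑ s' = ∀ u → State.R s u ⊑ᵗ State.R s' u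

  ⊑ᵗ-refl : ∀ {t} {ts : TState P t} → ts ⊑ᵗ ts
  ⊑ᵗ-refl = record { fetched-kept = λ _ _ → refl ; read-kept = λ _ eq → eq }

  append-⊑ᵗ : ∀ {t} (ts : TState P t) ι → ts ⊑ᵗ record ts { F = F ts ++ [ ι ] }
  append-⊑ᵗ ts ι = record { fetched-kept = at-++ˡ (F ts) [ ι ] ; read-kept = λ _ eq → eq }

  read-⊑ᵗ : ∀ {t} (ts : TState P t) i x → L ts i ≡ nothing →
            ts ⊑ᵗ record ts { L = updN i (just x) (L ts) }
  read-⊑ᵗ ts i x unread = record { fetched-kept = λ _ _ → refl
                                 ; read-kept = λ j → updN-keeps-just i j unread }

  commit-⊑ᵗ : ∀ {t} (ts : TState P t) i → ts ⊑ᵗ record ts { C = updN i true (C ts) }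
  commit-⊑ᵗ ts i = record { fetched-kept = λ _ _ → refl ; read-kept = λ _ eq → eq }

  updR-⊑ : ∀ t f (g : (u : Tid P) → TState P u) → g t ⊑ᵗ f (g t) →
           ∀ u → g u ⊑ᵗ updR P t f g u
  updR-⊑ t f g gt⊑ u with t ≟ u
  ... | yes refl = gt⊑
  ... | no _     = ⊑ᵗ-refl

  step-⊑ : ∀ {s ℓ s'} → Step P s ℓ s' → s ⊑ s'
  step-⊑ {s} (FETCH {t} {ι} _ _) = updR-⊑ t _ (State.R s) (append-⊑ᵗ _ ι)
  step-⊑ {s} (LOAD {t} {i} _ unread _) = updR-⊑ t _ (State.R s) (read-⊑ᵗ _ i _ unread)
  step-⊑ {s} (EARLY {t} {i} _ unread _ _ _ _ _ _ _) =
    updR-⊑ t _ (State.R s) (read-⊑ᵗ _ i _ unread)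
  step-⊑ {s} (COMMIT {t} {i} _ _ _) = updR-⊑ t _ (State.R s) (commit-⊑ᵗ _ i)
  step-⊑ {s} (STORE {t} {i} _ _ _ _ _ _ _ _) = updR-⊑ t _ (State.R s) (commit-⊑ᵗ _ i)
  step-⊑ (PROP _ _ _ _ _ _ _) _ = ⊑ᵗ-refl

  cmdAt-just⇒< : ∀ s {u j c} → cmdAt P s u j ≡ just c → j < length (Fs P s u)
  cmdAt-just⇒< s {u} {j} eq with at (Fs P s u) j in at≡
  ... | just _ = at-just⇒< (Fs P s u) j at≡

  module _ {s s' : State P} (s⊑s' : s ⊑ s') where
    open _⊑ᵗ_

    <length-kept : ∀ {u j} → j < length (Fs P s u) → j < length (Fs P s' u)
    <length-kept {u} {j} j< with <⇒at-just (Fs P s u) j j<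
    ... | _ , at≡ = at-just⇒< (Fs P s' u) j (trans (fetched-kept (s⊑s' u) j j<) at≡)

    cmdAt-kept : ∀ {u j} → j < length (Fs P s u) → cmdAt P s' u j ≡ cmdAt P s u j
    cmdAt-kept {u} {j} j< = cong (Maybe.map Instr.cmd) (fetched-kept (s⊑s' u) j j<)

    cmdAt-just-kept : ∀ {u j c} → cmdAt P s u j ≡ just c → cmdAt P s' u j ≡ just c
    cmdAt-just-kept eq = trans (cmdAt-kept (cmdAt-just⇒< s eq)) eq

    Ls-just-kept : ∀ {u j x} → Ls P s u j ≡ just x → Ls P s' u j ≡ just x
    Ls-just-kept {u} {j} = read-kept (s⊑s' u) j

    NoDefBetween-kept : ∀ {u lo hi r} → hi < length (Fs P s u) →
                        NoDefBetween P s u lo hi r → NoDefBetween P s' u lo hi r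
    NoDefBetween-kept hi< noDef j c lo<j j<hi eq =
      noDef j c lo<j j<hi (trans (sym (cmdAt-kept (<-trans j<hi hi<))) eq)

    NoDefBefore-kept : ∀ {u hi r} → hi < length (Fs P s u) →
                       NoDefBefore P s u hi r → NoDefBefore P s' u hi r
    NoDefBefore-kept hi< noDef j c j<hi eq =
      noDef j c j<hi (trans (sym (cmdAt-kept (<-trans j<hi hi<))) eq)

    mutual
      Eval-defined-kept : ∀ {u i e w} → i < length (Fs P s u) → w ≢ nothing →
                          Eval P s u i e w → Eval P s' u i e w
      Eval-defined-kept i< defined ev-const = ev-const
      Eval-defined-kept i< defined (ev-app {f = f} {vs = vs} args) =
        ev-app (EvalArgs-defined-kept i< args-defined args)
        where args-defined = allJust-defined⇒All vs (map-defined f (allJust vs) defined)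
      Eval-defined-kept i< defined (ev-reg-none noDef) = ev-reg-none (NoDefBefore-kept i< noDef)
      Eval-defined-kept i< defined (ev-reg-assign i'<i noDef def ev) =
        ev-reg-assign i'<i (NoDefBetween-kept i< noDef) (cmdAt-just-kept def)
          (Eval-defined-kept (<-trans i'<i i<) defined ev)
      Eval-defined-kept i< defined (ev-reg-load-bot _ _ _ _) = ⊥-elim (defined refl)
      Eval-defined-kept i< defined (ev-reg-load-init i'<i noDef def read) =
        ev-reg-load-init i'<i (NoDefBetween-kept i< noDef) (cmdAt-just-kept def) (Ls-just-kept read)
      Eval-defined-kept i< defined (ev-reg-load-prog i'<i noDef def read st ev) =
        ev-reg-load-prog i'<i (NoDefBetween-kept i< noDef) (cmdAt-just-kept def) (Ls-just-kept read)
          (cmdAt-just-kept st) (Eval-defined-kept (cmdAt-just⇒< s st) defined ev)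

      EvalArgs-defined-kept : ∀ {u i k} {es : Vec (Expr nD nR) k} {vs} → i < length (Fs P s u) →
                              All (_≢ nothing) vs → EvalArgs P s u i es vs → EvalArgs P s' u i es vs
      EvalArgs-defined-kept i< [] [] = []
      EvalArgs-defined-kept i< (defined ∷ defineds) (ev ∷ evs) =
        Eval-defined-kept i< defined ev ∷ EvalArgs-defined-kept i< defineds evs

    EvalAt-just-kept : ∀ {u i e v} → EvalAt P s u i e (just v) → EvalAt P s' u i e (just v)
    EvalAt-just-kept (i< , ev) = <length-kept i< , Eval-defined-kept i< (λ ()) ev

lemma3 : ∀ {nD nR : ℕ} (P : Program nD nR) (σ : List (Label P)) (s s' : State P)
    (e : Label P) (t : Tid P) (i : ℕ) (e₀ : Expr nD nR) (v : Val nD) →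
    Reach P σ s → Step P s e s' →
    EvalAt P s t i e₀ (just v) → EvalAt P s' t i e₀ (just v)
lemma3 P σ s s' e t i e₀ v _ step = EvalAt-just-kept P (step-⊑ P step)
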